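{- Let $\mathcal{G} = (V, E_1,\dots,E_T)$ be an always connected broadcast network with $n \ge 2$ vertices, let $\delta = \min_{v \in V}\Delta(v)$, and assume $T \ge (\delta+1)(2n-3)$. Then $\mathcal{G}$ can be explored (from any starting vertex) by a temporal walk of length at most $(\delta+1)(2n-3)$.
   Context: $\mathcal{G} = (V, E_1,\dots,E_T)$ is a directed temporal graph with symmetric underlying graph $U(\mathcal{G}) = (V, E)$, $E = \bigcup_t E_t$; $N(v)$ denotes the neighbours of $v$ in $U(\mathcal{G})$ and $\Delta(v) = |N(v)|$. A vertex $v$ is active at timestep $t$ if $\{(v,u) : u \in N(v)\} \subseteq E_t$; $A_t$ is the set of active vertices at $t$. $\mathcal{G}$ is a broadcast network if (i) for every $v$ and $t$, either all out-edges $(v,u)$, $u\in N(v)$, lie in $E_t$ or none do; and (ii) whenever $v \in A_{t_1} \cap A_{t_2}$ with $t_1 < t_2$, every $u \in N(v)$ belongs to $A_{t_u}$ for some $t_u \in [t_1, t_2-1]$. It is always connected if every static graph $(V,E_t)$ is connected. A temporal walk is a sequence $((v_{i_1},v_{i_2}),t_1), \dots, ((v_{i_{m-1}},v_{i_m}),t_{m-1})$ of edges forming a walk with $(v_{i_j},v_{i_{j+1}}) \in E_{t_j}$ and $t_1<\dots<t_{m-1}$; its length is $t_{m-1}$; it explores $\mathcal{G}$ if every vertex lies on some edge of the walk. -}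

module Defs where

open import Data.Nat using (ℕ; zero; suc; _+_; _*_; _∸_; _≤_; _<_)
open import Data.Fin using (Fin)
open import Data.Bool using (Bool; true; false; if_then_else_; _∨_)
open import Data.List using (List; map; upTo; allFin)
open import Data.Bool.ListAction using (any)
open import Data.Nat.ListAction using (sum)
open import Data.Product using (Σ; _×_; _,_; ∃-syntax)
open import Data.Sum using (_⊎_)
open import Relation.Binary.PropositionalEquality using (_≡_)
open import Relation.Nullary using (¬_)

-- A temporal graph on vertex set Fin n with lifetime T:
-- E t u v ≡ true  means the directed edge (u,v) belongs to E_t  (only 1 ≤ t ≤ T is relevant).
TemporalGraph : ℕ → Set
TemporalGraph n = ℕ → Fin n → Fin n → Bool

module _ {n : ℕ} (T : ℕ) (E : TemporalGraph n) where

  times : List ℕ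
  times = map suc (upTo T)

  inUnderlying : Fin n → Fin n → Bool
  inUnderlying v u = any (λ t → E t v u) times

  Nb : Fin n → Fin n → Set
  Nb v u = inUnderlying v u ≡ true

  Δ : Fin n → ℕ
  Δ v = sum (map (λ u → if inUnderlying v u then 1 else 0) (allFin n))

  IsMinDegree : ℕ → Set
  IsMinDegree δ = (∃[ v ] Δ v ≡ δ) × (∀ v → δ ≤ Δ v)

  NoLoops : Set
  NoLoops = ∀ t v → E t v v ≡ false

  SymmetricUnderlying : Set
  SymmetricUnderlying = ∀ u v → Nb u v → Nb v u

  Active : ℕ → Fin n → Set
  Active t v = ∀ u → Nb v u → E t v u ≡ true

  IsBroadcast : Set
  IsBroadcast =
    (∀ t v → 1 ≤ t → t ≤ T →
       (∀ u → Nb v u → E t v u ≡ true) ⊎ (∀ u → Nb v u → E t v u ≡ false))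
    × (∀ v t₁ t₂ → 1 ≤ t₁ → t₁ < t₂ → t₂ ≤ T → Active t₁ v → Active t₂ v →
         ∀ u → Nb v u → ∃[ tᵤ ] (t₁ ≤ tᵤ × tᵤ ≤ t₂ ∸ 1 × Active tᵤ u))

  data Conn (t : ℕ) (x : Fin n) : Fin n → Set where
    here : Conn t x x
    fwd  : ∀ {y z} → Conn t x y → E t y z ≡ true → Conn t x z
    bwd  : ∀ {y z} → Conn t x y → E t z y ≡ true → Conn t x z

  AlwaysConnected : Set
  AlwaysConnected = ∀ t → 1 ≤ t → t ≤ T → ∀ x y → Conn t x y

  data WalkFrom (v : Fin n) (t₀ : ℕ) : Set where
    stop : WalkFrom v t₀
    step : (u : Fin n) (t : ℕ) → t₀ < t → t ≤ T → E t v u ≡ true →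
           WalkFrom u t → WalkFrom v t₀

  -- length of the walk = time label of its last edge (0 for the empty walk from time 0)
  lengthW : ∀ {v t₀} → WalkFrom v t₀ → ℕ
  lengthW {t₀ = t₀} stop = t₀
  lengthW (step u t _ _ _ w) = lengthW w

  data OnEdge (x : Fin n) : ∀ {v t₀} → WalkFrom v t₀ → Set where
    src  : ∀ {t₀ u t p q e w} → OnEdge x {x} {t₀} (step u t p q e w)
    tgt  : ∀ {v t₀ t p q e w} → OnEdge x {v} {t₀} (step x t p q e w)
    rest : ∀ {v t₀ u t p q e w} → OnEdge x w → OnEdge x {v} {t₀} (step u t p q e w)

  Explores : ∀ {v t₀} → WalkFrom v t₀ → Set
  Explores w = ∀ x → OnEdge x w

module Submission where

-- Fix a vertex w of degree d. Whenever w is inactive one of its neighbours is active, and by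
-- condition (ii) w is active between two activations of the same neighbour; so w is active in
-- every d + 1 consecutive steps and has 2n − 3 increasing activation times by step (d + 1)(2n − 3).
-- Condition (ii) also turns k increasing activations of u into k − 1 increasing activations of any
-- neighbour of u, all strictly earlier; along a static walk from w this gives decreasing times, so
-- the walk read backwards is a temporal walk. It remains to find a static walk w ⇝ p ⇝ s plus one
-- extra neighbour of p such that the part p ⇝ s and that neighbour visit every vertex and the walk
-- has length at most 2n − 4. Such sweeps are grown one vertex at a time across cut edges, starting
-- from two neighbours of w, or from one when s = w. If d = 1 and s ≠ w, the neighbour of w takes
-- over the role of w, being active in every two consecutive steps.

open import Defs
open import Data.Nat using (ℕ; zero; suc; _+_; _*_; _∸_; _≤_; _<_; z≤n; s≤s; anyUpTo?)
open import Data.Nat.Properties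
open import Data.Nat.ListAction using (sum)
open import Data.Fin as Fin using (Fin; toℕ) renaming (zero to fzero; suc to fsuc)
open import Data.Fin.Properties
  using (injective⇒≤; pigeonhole; toℕ<n; all?; ¬∀⟶∃¬) renaming (_≟_ to _≟ᶠ_)
open import Data.Bool using (Bool; true; false; if_then_else_) renaming (T to True; _≟_ to _≟ᵇ_)
open import Data.Bool.Properties using (T-≡)
open import Data.List using (List; []; _∷_; length; lookup; filter; map; allFin)
open import Data.List.Membership.Propositional using (_∈_; _∉_; lose)
open import Data.List.Membership.Propositional.Properties
  using (∈-lookup; ∈-length; ∈-allFin; ∈-filter⁺; ∈-filter⁻; ∈-map⁺; ∈-upTo⁺)
open import Data.List.Membership.Setoid.Properties using (index-injective)
open import Data.List.Relation.Unary.Any using (here; there; index; satisfied)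
open import Data.List.Relation.Unary.Any.Properties using (any⁺; any⁻)
open import Data.List.Relation.Unary.All as All using ([]; _∷_)
open import Data.List.Relation.Unary.All.Properties using (¬Any⇒All¬)
open import Data.List.Relation.Unary.AllPairs using ([]; _∷_)
open import Data.List.Relation.Unary.Unique.Propositional using (Unique)
open import Data.List.Relation.Unary.Unique.Propositional.Properties using (filter⁺; allFin⁺)
open import Data.List.Relation.Binary.Permutation.Propositional using (_↭_; ↭-sym; swap; refl)
open import Data.List.Relation.Binary.Permutation.Propositional.Properties using (∈-resp-↭; ↭-length)
open import Data.Product using (Σ; _×_; _,_; ∃; ∃₂; ∃-syntax; proj₁; proj₂)
open import Data.Sum using (_⊎_; inj₁; inj₂; [_,_]; [_,_]′; map₁)
open import Data.Empty using (⊥-elim)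
open import Function using (_∘_; id; case_of_)
open import Function.Bundles using (Equivalence)
open import Level using (0ℓ)
open import Relation.Nullary using (¬_; Dec; yes; no)
open import Relation.Nullary.Decidable using (_→-dec_)
open import Relation.Binary.Core using (Rel)
open import Relation.Binary.Definitions using (Symmetric; Irreflexive)
open import Relation.Binary.PropositionalEquality hiding ([_])

lookup-injective : ∀ {A : Set} {xs : List A} → Unique xs → ∀ {i j} → lookup xs i ≡ lookup xs j → i ≡ j
lookup-injective (_ ∷ _)      {fzero}  {fzero}  _  = refl
lookup-injective (x≢ ∷ _)     {fzero}  {fsuc j} eq = ⊥-elim (All.lookup x≢ (∈-lookup j) eq)
lookup-injective (x≢ ∷ _)     {fsuc i} {fzero}  eq = ⊥-elim (All.lookup x≢ (∈-lookup i) (sym eq))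
lookup-injective (_ ∷ unique) {fsuc i} {fsuc j} eq = cong fsuc (lookup-injective unique eq)

Unique⇒length≤ : ∀ {n} {xs : List (Fin n)} → Unique xs → length xs ≤ n
Unique⇒length≤ unique = injective⇒≤ (lookup-injective unique)

module _ {n : ℕ} where
  open import Data.List.Membership.DecPropositional (_≟ᶠ_ {n}) using (_∈?_)

  full-or-missing : (S : List (Fin n)) → (∀ z → z ∈ S) ⊎ ∃ λ z → z ∉ S
  full-or-missing S with all? (_∈? S)
  ... | yes full = inj₁ full
  ... | no ¬full = inj₂ (¬∀⟶∃¬ n (_∈ S) (_∈? S) ¬full)

length-filter-≡true : ∀ {A : Set} (b : A → Bool) (xs : List A) →
                      length (filter (λ x → b x ≟ᵇ true) xs) ≡ sum (map (λ x → if b x then 1 else 0) xs)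
length-filter-≡true b []       = refl
length-filter-≡true b (x ∷ xs) with b x
... | true  = cong suc (length-filter-≡true b xs)
... | false = length-filter-≡true b xs

in-window : ∀ {a t L} → a < t → t ≤ a + L → ∃ λ i → i < L × t ≡ a + suc i
in-window {a} {t} a<t t≤a+L = t ∸ suc a , +-cancelˡ-≤ a _ _ (subst (_≤ a + _) t≡ t≤a+L) , t≡
  where
    t≡ : t ≡ a + suc (t ∸ suc a)
    t≡ = sym (trans (+-suc a (t ∸ suc a)) (m+[n∸m]≡n a<t))

another-element : ∀ {n} → 2 ≤ n → (v : Fin n) → ∃ λ z → z ≢ v
another-element (s≤s (s≤s _)) fzero    = fsuc fzero , λ ()
another-element (s≤s (s≤s _)) (fsuc v) = fzero , λ ()

-- Sweeps in a static graph

module Spanning {n : ℕ} (_~_ : Rel (Fin n) 0ℓ) where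

  EveryCutCrossed : Set
  EveryCutCrossed = ∀ {S x z} → x ∈ S → z ∉ S → ∃₂ λ y y′ → y ∈ S × y′ ∉ S × y ~ y′

  grow : EveryCutCrossed → (P : List (Fin n) → Set) →
         (∀ {S x y} → P S → x ∉ S → y ∈ S → y ~ x → P (x ∷ S)) →
         ∀ {S x} → Unique S → x ∈ S → P S →
         ∃ λ S′ → (∀ z → z ∈ S′) × Unique S′ × P S′
  grow crossed P extend = go n (m≤m+n n _)
    where
      go : ∀ fuel {S x} → n ≤ fuel + length S → Unique S → x ∈ S → P S →
           ∃ λ S′ → (∀ z → z ∈ S′) × Unique S′ × P S′
      go fuel {S} bound unique x∈S p with full-or-missing S
      ... | inj₁ full = S , full , unique , p
      go zero       bound unique x∈S p | inj₂ (z , z∉S) =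
        ⊥-elim (<-irrefl refl (≤-trans (s≤s bound) (Unique⇒length≤ (¬Any⇒All¬ _ z∉S ∷ unique))))
      go (suc fuel) {S} bound unique x∈S p | inj₂ (z , z∉S) with crossed x∈S z∉S
      ... | y , y′ , y∈S , y′∉S , y~y′ =
        go fuel (≤-trans bound (≤-reflexive (sym (+-suc fuel (length S)))))
           (¬Any⇒All¬ _ y′∉S ∷ unique) (there x∈S) (extend p y′∉S y∈S y~y′)

module Sweeps {n : ℕ} (_~_ : Rel (Fin n) 0ℓ) (~-sym : Symmetric _~_) (~-irrefl : Irreflexive _≡_ _~_)
  where

  open Spanning _~_ public

  infixr 5 _◅_
  data Walk : Fin n → Fin n → ℕ → Set where
    ε   : ∀ {v} → Walk v v 0
    _◅_ : ∀ {v u w k} → v ~ u → Walk u w k → Walk v w (suc k)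

  infix 4 _∈ʷ_
  data _∈ʷ_ (z : Fin n) : ∀ {v w k} → Walk v w k → Set where
    end  : z ∈ʷ ε {z}
    head : ∀ {u w k} {e : z ~ u} {p : Walk u w k} → z ∈ʷ e ◅ p
    tail : ∀ {v u w k} {e : v ~ u} {p : Walk u w k} → z ∈ʷ p → z ∈ʷ e ◅ p

  _⊆ʷ_ : ∀ {v w v′ w′ k k′} → Walk v w k → Walk v′ w′ k′ → Set
  p ⊆ʷ q = ∀ {z} → z ∈ʷ p → z ∈ʷ q

  infixl 5 _▷_
  _▷_ : ∀ {v w x k} → Walk v w k → w ~ x → Walk v x (suc k)
  ε ▷ e = e ◅ ε
  (e′ ◅ p) ▷ e = e′ ◅ (p ▷ e)

  ⊆-▷ : ∀ {v w x k} (p : Walk v w k) (e : w ~ x) → p ⊆ʷ (p ▷ e)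
  ⊆-▷ ε        e end      = head
  ⊆-▷ (e′ ◅ p) e head     = head
  ⊆-▷ (e′ ◅ p) e (tail m) = tail (⊆-▷ p e m)

  end∈▷ : ∀ {v w x k} (p : Walk v w k) (e : w ~ x) → x ∈ʷ p ▷ e
  end∈▷ ε        e = tail end
  end∈▷ (e′ ◅ p) e = tail (end∈▷ p e)

  detour : ∀ {v w y x k} (p : Walk v w k) → y ∈ʷ p → y ~ x →
           Σ (Walk v w (2 + k)) λ q → p ⊆ʷ q × x ∈ʷ q
  detour ε end e = e ◅ ~-sym e ◅ ε , (λ { end → head }) , tail head
  detour (e′ ◅ p) head e =
    e ◅ ~-sym e ◅ e′ ◅ p , (λ { head → head ; (tail m) → tail (tail (tail m)) }) , tail head
  detour (e′ ◅ p) (tail y∈p) e with detour p y∈p e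
  ... | q , p⊆q , x∈q = e′ ◅ q , (λ { head → head ; (tail m) → tail (p⊆q m) }) , tail x∈q

  -- A sweep is read as a route s ⇝ pivot → tip along trail reversed; stem only transports
  -- activation times from the root r to the pivot.
  record Sweep (r : Fin n) (S : List (Fin n)) (s : Fin n) : Set where
    field
      pivot tip : Fin n
      ℓ₁ ℓ₂     : ℕ
      stem      : Walk r pivot ℓ₁
      trail     : Walk pivot s ℓ₂
      pivot~tip : pivot ~ tip
      covers    : ∀ {z} → z ∈ S → z ∈ʷ trail ⊎ z ≡ tip
      short     : ℓ₁ + ℓ₂ + 4 ≤ 2 * length S

  private
    short-step : ∀ {a b L} → a + 4 ≤ 2 * L → b ≤ 2 + a → b + 4 ≤ 2 * suc L
    short-step {a} {b} {L} a+4≤ b≤ = begin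
      b + 4         ≤⟨ +-monoˡ-≤ 4 b≤ ⟩
      2 + (a + 4)   ≤⟨ s≤s (s≤s a+4≤) ⟩
      2 + 2 * L     ≡⟨ sym (*-suc 2 L) ⟩
      2 * suc L     ∎
      where open ≤-Reasoning

  sweep-retarget : ∀ {r S y x} → Sweep r S y → y ~ x → Sweep r (x ∷ S) x
  sweep-retarget σ y~x = record
    { Sweep σ hiding (ℓ₂; trail; covers; short)
    ; ℓ₂     = suc ℓ₂
    ; trail  = trail ▷ y~x
    ; covers = λ { (here refl) → inj₁ (end∈▷ trail y~x)
                 ; (there z∈S) → map₁ (⊆-▷ trail y~x) (covers z∈S) }
    ; short  = short-step short (≤-trans (≤-reflexive (+-suc ℓ₁ ℓ₂)) (n≤1+n _))
    }
    where open Sweep σ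

  sweep-extend : ∀ {r S s y x} → Sweep r S s → y ∈ S → y ~ x → Sweep r (x ∷ S) s
  sweep-extend σ y∈S y~x with Sweep.covers σ y∈S
  ... | inj₁ y∈trail = record
    { Sweep σ hiding (ℓ₂; trail; covers; short)
    ; ℓ₂     = 2 + ℓ₂
    ; trail  = proj₁ d
    ; covers = λ { (here refl) → inj₁ (proj₂ (proj₂ d))
                 ; (there z∈S) → map₁ (proj₁ (proj₂ d)) (covers z∈S) }
    ; short  = short-step short (≤-reflexive (trans (+-suc ℓ₁ (suc ℓ₂)) (cong suc (+-suc ℓ₁ ℓ₂))))
    }
    where open Sweep σ
          d = detour trail y∈trail y~x
  ... | inj₂ refl = record
    { pivot     = tip
    ; tip       = _
    ; ℓ₁        = suc ℓ₁
    ; ℓ₂        = suc ℓ₂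
    ; stem      = stem ▷ pivot~tip
    ; trail     = ~-sym pivot~tip ◅ trail
    ; pivot~tip = y~x
    ; covers    = λ { (here refl) → inj₂ refl
                    ; (there z∈S) → inj₁ ([ tail , (λ { refl → head }) ] (covers z∈S)) }
    ; short     = short-step short (≤-reflexive (cong suc (+-suc ℓ₁ ℓ₂)))
    }
    where open Sweep σ

  sweep-resp-↭ : ∀ {r S S′ s} → S ↭ S′ → Sweep r S s → Sweep r S′ s
  sweep-resp-↭ S↭S′ σ = record
    { Sweep σ hiding (covers; short)
    ; covers = covers ∘ ∈-resp-↭ (↭-sym S↭S′)
    ; short  = subst (λ L → ℓ₁ + ℓ₂ + 4 ≤ 2 * L) (↭-length S↭S′) short
    }
    where open Sweep σ

  root-sweep : ∀ {r a} → r ~ a → Sweep r (a ∷ r ∷ []) r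
  root-sweep r~a = record
    { pivot = _ ; tip = _ ; ℓ₁ = 0 ; ℓ₂ = 0 ; stem = ε ; trail = ε ; pivot~tip = r~a
    ; covers = λ { (here refl) → inj₂ refl ; (there (here refl)) → inj₁ end }
    ; short = ≤-refl
    }

  fork-sweep : ∀ {r a b s} → r ~ a → r ~ b → s ∈ b ∷ a ∷ r ∷ [] → Sweep r (b ∷ a ∷ r ∷ []) s
  fork-sweep r~a r~b (here refl)                 = sweep-retarget (root-sweep r~a) r~b
  fork-sweep r~a r~b (there (here refl))         =
    sweep-resp-↭ (swap _ _ refl) (sweep-retarget (root-sweep r~b) r~a)
  fork-sweep r~a r~b (there (there (here refl))) = sweep-extend (root-sweep r~a) (there (here refl)) r~b

  neighbour≢ : ∀ {r x} → r ~ x → x ≢ r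
  neighbour≢ r~x x≡r = ~-irrefl (sym x≡r) r~x

  SpanningSweep : Fin n → Fin n → Set
  SpanningSweep r s = ∃ λ S → (∀ z → z ∈ S) × Unique S × Sweep r S s

  spanning-root-sweep : EveryCutCrossed → ∀ {r a} → r ~ a → SpanningSweep r r
  spanning-root-sweep crossed {r} r~a =
    grow crossed (λ S → Sweep r S r) (λ σ _ → sweep-extend σ)
         ((neighbour≢ r~a ∷ []) ∷ [] ∷ []) (there (here refl)) (root-sweep r~a)

  spanning-fork-sweep : EveryCutCrossed → ∀ {r a b} → r ~ a → r ~ b → a ≢ b → ∀ s → SpanningSweep r s
  spanning-fork-sweep crossed {r} {a} {b} r~a r~b a≢b s
    with grow crossed (λ S → ∀ {s} → s ∈ S → Sweep r S s) extend
              ((a≢b ∘ sym ∷ neighbour≢ r~b ∷ []) ∷ (neighbour≢ r~a ∷ []) ∷ [] ∷ [])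
              (here refl) (fork-sweep r~a r~b)
    where
      extend : ∀ {S x y} → (∀ {s} → s ∈ S → Sweep r S s) → x ∉ S → y ∈ S → y ~ x →
               ∀ {s} → s ∈ x ∷ S → Sweep r (x ∷ S) s
      extend σ _ y∈S y~x (here refl) = sweep-retarget (σ y∈S) y~x
      extend σ _ y∈S y~x (there s∈S) = sweep-extend (σ s∈S) y∈S y~x
  ... | S , full , unique , σ = S , full , unique , σ (full s)

-- Broadcast networks

module BroadcastExploration {n : ℕ} (n≥2 : 2 ≤ n) (T : ℕ) (T≥1 : 1 ≤ T) (E : TemporalGraph n)
  (no-loops : NoLoops T E) (symmetric : SymmetricUnderlying T E) (broadcast : IsBroadcast T E)
  (connected : AlwaysConnected T E) where

  _~_ : Fin n → Fin n → Set
  _~_ = Nb T E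

  edge⇒~ : ∀ {t v u} → 1 ≤ t → t ≤ T → E t v u ≡ true → v ~ u
  edge⇒~ {suc t} {v} {u} _ t≤T e =
    Equivalence.to T-≡ (any⁺ (λ t → E t v u) (lose (∈-map⁺ suc (∈-upTo⁺ t≤T)) (Equivalence.from T-≡ e)))

  ~-irrefl : Irreflexive _≡_ _~_
  ~-irrefl {v} refl v~v with satisfied (any⁻ (λ t → E t v v) (times T E) (Equivalence.from T-≡ v~v))
  ... | t , loop = subst True (no-loops t v) loop

  ~-sym : Symmetric _~_
  ~-sym = symmetric _ _

  open Sweeps _~_ ~-sym ~-irrefl

  cuts-crossed : EveryCutCrossed
  cuts-crossed {S} {x} {z} x∈S z∉S = leave (connected 1 ≤-refl T≥1 x z) z∉S
    where
      open import Data.List.Membership.DecPropositional (_≟ᶠ_ {n}) using (_∈?_)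
      leave : ∀ {y} → Conn T E 1 x y → y ∉ S → ∃₂ λ y y′ → y ∈ S × y′ ∉ S × y ~ y′
      leave here y∉S = ⊥-elim (y∉S x∈S)
      leave (fwd {y} c e) z∉S with y ∈? S
      ... | yes y∈S = y , _ , y∈S , z∉S , edge⇒~ ≤-refl T≥1 e
      ... | no  y∉S = leave c y∉S
      leave (bwd {y} c e) z∉S with y ∈? S
      ... | yes y∈S = y , _ , y∈S , z∉S , ~-sym (edge⇒~ ≤-refl T≥1 e)
      ... | no  y∉S = leave c y∉S

  edge-at : ∀ {t v z} → Conn T E t v z → z ≢ v → ∃ λ u → E t v u ≡ true ⊎ E t u v ≡ true
  edge-at here z≢v = ⊥-elim (z≢v refl)
  edge-at {v = v} (fwd {y} c e) z≢v with y ≟ᶠ v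
  ... | yes refl = _ , inj₁ e
  ... | no  y≢v  = edge-at c y≢v
  edge-at {v = v} (bwd {y} c e) z≢v with y ≟ᶠ v
  ... | yes refl = _ , inj₂ e
  ... | no  y≢v  = edge-at c y≢v

  incident-edge : ∀ {t} → 1 ≤ t → t ≤ T → ∀ v → ∃ λ u → E t v u ≡ true ⊎ E t u v ≡ true
  incident-edge 1≤t t≤T v with another-element n≥2 v
  ... | z , z≢v = edge-at (connected _ 1≤t t≤T v z) z≢v

  has-neighbour : ∀ v → ∃ (v ~_)
  has-neighbour v with incident-edge ≤-refl T≥1 v
  ... | u , inj₁ e = u , edge⇒~ ≤-refl T≥1 e
  ... | u , inj₂ e = u , ~-sym (edge⇒~ ≤-refl T≥1 e)

  active? : ∀ t v → Dec (Active T E t v)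
  active? t v = all? (λ u → (inUnderlying T E v u ≟ᵇ true) →-dec (E t v u ≟ᵇ true))

  edge⇒active : ∀ {t v u} → 1 ≤ t → t ≤ T → E t v u ≡ true → Active T E t v
  edge⇒active {t} {v} {u} 1≤t t≤T e with proj₁ broadcast t v 1≤t t≤T
  ... | inj₁ active = active
  ... | inj₂ silent = case trans (sym e) (silent u (edge⇒~ 1≤t t≤T e)) of λ ()

  inactive⇒active-neighbour : ∀ {t v} → 1 ≤ t → t ≤ T → ¬ Active T E t v →
                              ∃ λ u → v ~ u × Active T E t u
  inactive⇒active-neighbour {v = v} 1≤t t≤T inactive with incident-edge 1≤t t≤T v
  ... | u , inj₁ e = ⊥-elim (inactive (edge⇒active 1≤t t≤T e))
  ... | u , inj₂ e = u , ~-sym (edge⇒~ 1≤t t≤T e) , edge⇒active 1≤t t≤T e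

  neighbours : Fin n → List (Fin n)
  neighbours v = filter (λ u → inUnderlying T E v u ≟ᵇ true) (allFin n)

  ∈-neighbours⁺ : ∀ {v u} → v ~ u → u ∈ neighbours v
  ∈-neighbours⁺ {u = u} = ∈-filter⁺ _ (∈-allFin u)

  ∈-neighbours⁻ : ∀ {v u} → u ∈ neighbours v → v ~ u
  ∈-neighbours⁻ {v} = proj₂ ∘ ∈-filter⁻ (λ u → inUnderlying T E v u ≟ᵇ true) {xs = allFin n}

  length-neighbours : ∀ v → length (neighbours v) ≡ Δ T E v
  length-neighbours v = length-filter-≡true (inUnderlying T E v) (allFin n)

  data DegreeView (w : Fin n) : Set where
    leaf : ∀ {q} → w ~ q → (∀ {u} → w ~ u → u ≡ q) → DegreeView w
    fork : ∀ {a b} → w ~ a → w ~ b → a ≢ b → DegreeView w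

  degree-view : ∀ w → DegreeView w
  degree-view w = view (neighbours w) (filter⁺ _ (allFin⁺ n)) ∈-neighbours⁺ ∈-neighbours⁻
    where
      view : ∀ xs → Unique xs → (∀ {u} → w ~ u → u ∈ xs) → (∀ {u} → u ∈ xs → w ~ u) → DegreeView w
      view []          _                complete _     = case complete (proj₂ (has-neighbour w)) of λ ()
      view (q ∷ [])    _                complete sound =
        leaf (sound (here refl)) (λ w~u → case complete w~u of λ { (here u≡q) → u≡q })
      view (a ∷ b ∷ _) ((a≢b ∷ _) ∷ _) _        sound =
        fork (sound (here refl)) (sound (there (here refl))) a≢b

  relay : ∀ {u v t₁ t₂} → u ~ v → 1 ≤ t₁ → t₁ < t₂ → t₂ ≤ T →
          Active T E t₁ u → Active T E t₂ u → ∃ λ t → t₁ ≤ t × t < t₂ × Active T E t v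
  relay {t₂ = suc t₂} u~v 1≤t₁ t₁<t₂ t₂≤T act₁ act₂
    with proj₂ broadcast _ _ _ 1≤t₁ t₁<t₂ t₂≤T act₁ act₂ _ u~v
  ... | t , t₁≤t , t≤t₂ , act = t , t₁≤t , s≤s t≤t₂ , act

  data Activations (x : Fin n) : ℕ → ℕ → Set where
    once  : ∀ {t} → 1 ≤ t → t ≤ T → Active T E t x → Activations x 1 t
    again : ∀ {k t t′} → Activations x (suc k) t → t < t′ → t′ ≤ T → Active T E t′ x →
            Activations x (suc (suc k)) t′

  last-activation : ∀ {x k t} → Activations x k t → 1 ≤ t × t ≤ T × Active T E t x
  last-activation (once 1≤t t≤T act)      = 1≤t , t≤T , act
  last-activation (again _ t<t′ t′≤T act) = ≤-trans (s≤s z≤n) t<t′ , t′≤T , act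

  activations-neighbour : ∀ {u v k t} → u ~ v → Activations u (suc (suc k)) t →
                          ∃ λ t′ → t′ < t × Activations v (suc k) t′
  activations-neighbour u~v (again A t₁<t₂ t₂≤T act₂) with last-activation A
  ... | 1≤t₁ , _ , act₁ with relay u~v 1≤t₁ t₁<t₂ t₂≤T act₁ act₂
  ... | tᵥ , t₁≤tᵥ , tᵥ<t₂ , actᵥ = tᵥ , tᵥ<t₂ , append A
    where
      tᵥ≤T = ≤-trans (<⇒≤ tᵥ<t₂) t₂≤T
      append : ∀ {k} → Activations _ (suc k) _ → Activations _ (suc k) tᵥ
      append (once _ _ _)        = once (≤-trans 1≤t₁ t₁≤tᵥ) tᵥ≤T actᵥ
      append A′@(again _ _ _ _) with activations-neighbour u~v A′
      ... | t′ , t′<t₁ , B = again B (<-≤-trans t′<t₁ t₁≤tᵥ) tᵥ≤T actᵥ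

  activations-along : ∀ {x y ℓ m t} → Walk x y ℓ → Activations x (suc (ℓ + m)) t →
                      ∃ λ t′ → t′ ≤ t × Activations y (suc m) t′
  activations-along ε A = _ , ≤-refl , A
  activations-along (x~u ◅ p) A with activations-neighbour x~u A
  ... | t′ , t′<t , B with activations-along p B
  ... | t″ , t″≤t′ , C = t″ , ≤-trans t″≤t′ (<⇒≤ t′<t) , C

  RegularlyActive : Fin n → ℕ → Set
  RegularlyActive x L = ∀ a → a + L ≤ T → ∃ λ i → i < L × Active T E (a + suc i) x

  regular-activations : ∀ {x L} → RegularlyActive x L → ∀ k → L * suc k ≤ T →
                        ∃ λ t → t ≤ L * suc k × Activations x (suc k) t
  regular-activations {L = L} reg zero L≤T
    with reg 0 (subst (_≤ T) (*-identityʳ L) L≤T)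
  ... | i , i<L , act = suc i , ≤-trans i<L L≤L*1 , once (s≤s z≤n) (≤-trans i<L (≤-trans L≤L*1 L≤T)) act
    where L≤L*1 = ≤-reflexive (sym (*-identityʳ L))
  regular-activations {x} {L} reg (suc k) bound =
    next (regular-activations reg k (≤-trans (m≤n+m _ L) bound′))
    where
      bound′ : L + L * suc k ≤ T
      bound′ = subst (_≤ T) (*-suc L (suc k)) bound
      next : (∃ λ t → t ≤ L * suc k × Activations x (suc k) t) →
             ∃ λ t → t ≤ L * suc (suc k) × Activations x (suc (suc k)) t
      next (t , t≤ , A) =
        let i , i<L , act = reg t (≤-trans t+L≤ bound′)
            t′≤ = ≤-trans (+-monoʳ-≤ t i<L) (≤-trans t+L≤ (≤-reflexive (sym (*-suc L (suc k)))))
        in t + suc i , t′≤ , again A (m<m+n t (s≤s z≤n)) (≤-trans t′≤ bound) act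
        where
          t+L≤ : t + L ≤ L + L * suc k
          t+L≤ = ≤-trans (+-monoˡ-≤ L t≤) (≤-reflexive (+-comm _ L))

  active-in-window : ∀ {x a t L} → a < t → t ≤ a + L → Active T E t x →
                     ∃ λ i → i < L × Active T E (a + suc i) x
  active-in-window a<t t≤a+L act with in-window a<t t≤a+L
  ... | i , i<L , refl = i , i<L , act

  regular-by-neighbours : ∀ {w xs} → (∀ {u} → w ~ u → u ∈ xs) → RegularlyActive w (suc (length xs))
  regular-by-neighbours {w} {xs} complete a a+L≤T
    with anyUpTo? (λ i → active? (a + suc i) w) (suc (length xs))
  ... | yes found = found
  ... | no silent = ⊥-elim (no-repeat (pigeonhole ≤-refl slot))
    where
      time : Fin (suc (length xs)) → ℕ
      time i = a + suc (toℕ i)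
      a<time : ∀ i → a < time i
      a<time i = m<m+n a (s≤s z≤n)
      time≤ : ∀ i → time i ≤ a + suc (length xs)
      time≤ i = +-monoʳ-≤ a (toℕ<n i)
      witness : ∀ i → ∃ λ u → w ~ u × Active T E (time i) u
      witness i = inactive⇒active-neighbour (≤-trans (s≤s z≤n) (a<time i)) (≤-trans (time≤ i) a+L≤T)
                    (λ act → silent (toℕ i , toℕ<n i , act))
      slot : Fin (suc (length xs)) → Fin (length xs)
      slot i = index (complete (proj₁ (proj₂ (witness i))))
      no-repeat : ¬ ∃₂ λ i j → i Fin.< j × slot i ≡ slot j
      no-repeat (i , j , i<j , same-slot)
        with witness i | witness j
           | index-injective (setoid (Fin n)) (complete _) (complete _) same-slot
      ... | u , w~u , actᵢ | .u , _ , actⱼ | refl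
        with relay (~-sym w~u) (≤-trans (s≤s z≤n) (a<time i)) (+-monoʳ-< a (s≤s i<j))
                   (≤-trans (time≤ j) a+L≤T) actᵢ actⱼ
      ... | t , timeᵢ≤t , t<timeⱼ , act =
        silent (active-in-window (<-≤-trans (a<time i) timeᵢ≤t) (<⇒≤ (<-≤-trans t<timeⱼ (time≤ j))) act)

  leaf-regular : ∀ {w q} → (∀ {u} → w ~ u → u ≡ q) → RegularlyActive w 2
  leaf-regular {q = q} only-q = regular-by-neighbours {xs = q ∷ []} (here ∘ only-q)

  leaf-neighbour-regular : ∀ {w q} → (∀ {u} → w ~ u → u ≡ q) → w ~ q → RegularlyActive q 2
  leaf-neighbour-regular {w} {q} only-q w~q a a+2≤T with anyUpTo? (λ i → active? (a + suc i) q) 2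
  ... | yes found = found
  ... | no silent
    with relay w~q (1≤time 0) (+-monoʳ-< a ≤-refl) a+2≤T (w-active 0 (s≤s z≤n)) (w-active 1 ≤-refl)
    where
      1≤time : ∀ i → 1 ≤ a + suc i
      1≤time i = ≤-trans (s≤s z≤n) (m<m+n a (s≤s z≤n))
      w-active : ∀ i → i < 2 → Active T E (a + suc i) w
      w-active i i<2 with active? (a + suc i) w
      ... | yes active = active
      ... | no inactive
        with inactive⇒active-neighbour (1≤time i) (≤-trans (+-monoʳ-≤ a i<2) a+2≤T) inactive
      ...   | u , w~u , act rewrite only-q w~u = ⊥-elim (silent (i , i<2 , act))
  ... | t , a+1≤t , t<a+2 , act =
    ⊥-elim (silent (active-in-window (<-≤-trans (m<m+n a ≤-refl) a+1≤t) (<⇒≤ t<a+2) act))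

  leaf-neighbour-branches : ∀ {w q s} → (∀ {u} → w ~ u → u ≡ q) → s ≢ w → s ≢ q → ∃ λ y → q ~ y × w ≢ y
  leaf-neighbour-branches {w} {q} {s} only-q s≢w s≢q with cuts-crossed (here refl) s∉
    where
      s∉ : s ∉ w ∷ q ∷ []
      s∉ = λ { (here s≡w) → s≢w s≡w ; (there (here s≡q)) → s≢q s≡q ; (there (there ())) }
  ... | _ , y , here refl         , y∉ , w~y = ⊥-elim (y∉ (there (here (only-q w~y))))
  ... | _ , y , there (here refl) , y∉ , q~y = y , q~y , λ w≡y → y∉ (here (sym w≡y))
  ... | _ , _ , there (there ())  , _  , _

  -- Exploring along a sweep

  CoveringWalk : Fin n → ℕ → ℕ → (Fin n → Set) → Set
  CoveringWalk x t₀ B Q = Σ (WalkFrom T E x t₀) λ W → lengthW T E W ≤ B × (∀ {z} → Q z → OnEdge T E z W)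

  covering-mono : ∀ {x t₀ B} {Q Q′ : Fin n → Set} → (∀ {z} → Q′ z → Q z) →
                  CoveringWalk x t₀ B Q → CoveringWalk x t₀ B Q′
  covering-mono Q′⊆Q (W , len , covers) = W , len , covers ∘ Q′⊆Q

  follow-back : ∀ {x s ℓ m t B} {Q : Fin n → Set} → Q x → (p : Walk x s ℓ) →
                Activations x (suc (ℓ + m)) t →
                (∀ {t₀} → t₀ < t → CoveringWalk x t₀ B Q) → CoveringWalk s 0 B (λ z → Q z ⊎ z ∈ʷ p)
  follow-back Qx ε A onward =
    covering-mono [ id , (λ { end → Qx }) ] (onward (proj₁ (last-activation A)))
  follow-back {Q = Q} Qx (_◅_ {u = y} x~y p) A onward with activations-neighbour x~y A
  ... | t′ , t′<t , A′ = covering-mono shift (follow-back (inj₂ refl) p A′ onward′)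
    where
      onward′ : ∀ {t₀} → t₀ < t′ → CoveringWalk y t₀ _ (λ z → Q z ⊎ z ≡ y)
      onward′ t₀<t′ with last-activation A′ | onward t′<t
      ... | _ , t′≤T , act | W , len , covers =
        step _ t′ t₀<t′ t′≤T (act _ (~-sym x~y)) W , len , [ rest ∘ covers , (λ { refl → src }) ]
      shift : ∀ {z} → Q z ⊎ z ∈ʷ x~y ◅ p → (Q z ⊎ z ≡ y) ⊎ z ∈ʷ p
      shift (inj₁ q)        = inj₁ (inj₁ q)
      shift (inj₂ head)     = inj₁ (inj₁ Qx)
      shift (inj₂ (tail m)) = inj₂ m

  Exploration : Fin n → ℕ → Set
  Exploration s B = ∃ λ W → Explores T E {s} {0} W × lengthW T E W ≤ B

  sweep-exploration : ∀ {r S s t B} → (∀ z → z ∈ S) → (σ : Sweep r S s) →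
                      Activations r (suc (Sweep.ℓ₁ σ + Sweep.ℓ₂ σ)) t → t ≤ B → Exploration s B
  sweep-exploration {B = B} full σ Aᵣ t≤B with activations-along (Sweep.stem σ) Aᵣ
  ... | t₁ , t₁≤t , Aₚ = explored (follow-back (inj₁ refl) trail Aₚ′ finale)
    where
      open Sweep σ
      Aₚ′ : Activations pivot (suc (ℓ₂ + 0)) t₁
      Aₚ′ = subst (λ k → Activations pivot (suc k) t₁) (sym (+-identityʳ ℓ₂)) Aₚ
      finale : ∀ {t₀} → t₀ < t₁ → CoveringWalk pivot t₀ B (λ z → z ≡ pivot ⊎ z ≡ tip)
      finale t₀<t₁ with last-activation Aₚ
      ... | _ , t₁≤T , act = step tip t₁ t₀<t₁ t₁≤T (act tip pivot~tip) stop , ≤-trans t₁≤t t≤B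
                            , [ (λ { refl → src }) , (λ { refl → tgt }) ]
      explored : CoveringWalk _ 0 B (λ z → (z ≡ pivot ⊎ z ≡ tip) ⊎ z ∈ʷ trail) → Exploration _ B
      explored (W , len , covers′) =
        W , (λ z → covers′ ([ inj₂ , inj₁ ∘ inj₂ ]′ (covers (full z)))) , len

  explore-along-sweep : ∀ {r s L} → RegularlyActive r L → L * (2 * n ∸ 3) ≤ T → SpanningSweep r s →
                        Exploration s (L * (2 * n ∸ 3))
  explore-along-sweep {L = L} reg bound (S , full , unique , σ) =
    let t , t≤ , A = regular-activations reg (ℓ₁ + ℓ₂) (≤-trans B≤ bound)
    in sweep-exploration full σ A (≤-trans t≤ B≤)
    where
      open Sweep σ
      B≤ : L * suc (ℓ₁ + ℓ₂) ≤ L * (2 * n ∸ 3)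
      B≤ = *-monoʳ-≤ L (m+n≤o⇒m≤o∸n (suc (ℓ₁ + ℓ₂))
             (≤-trans (≤-reflexive (sym (+-suc (ℓ₁ + ℓ₂) 3)))
                      (≤-trans short (*-monoʳ-≤ 2 (Unique⇒length≤ unique)))))

  exploration-mono : ∀ {s B B′} → B ≤ B′ → Exploration s B → Exploration s B′
  exploration-mono B≤B′ (W , explores , len) = W , explores , ≤-trans len B≤B′

  leaf-exploration : ∀ {w q} → w ~ q → (∀ {u} → w ~ u → u ≡ q) → ∀ s →
                     2 * (2 * n ∸ 3) ≤ T → Exploration s (2 * (2 * n ∸ 3))
  leaf-exploration {w} {q} w~q only-q s bound with s ≟ᶠ w | s ≟ᶠ q
  ... | yes refl | _ =
    explore-along-sweep (leaf-regular only-q) bound (spanning-root-sweep cuts-crossed w~q)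
  ... | no _ | yes refl =
    explore-along-sweep (leaf-neighbour-regular only-q w~q) bound
                        (spanning-root-sweep cuts-crossed (~-sym w~q))
  ... | no s≢w | no s≢q with leaf-neighbour-branches only-q s≢w s≢q
  ...   | y , q~y , w≢y =
    explore-along-sweep (leaf-neighbour-regular only-q w~q) bound
                        (spanning-fork-sweep cuts-crossed (~-sym w~q) q~y w≢y s)

  exploration-within-degree : ∀ w s → suc (Δ T E w) * (2 * n ∸ 3) ≤ T →
                              Exploration s (suc (Δ T E w) * (2 * n ∸ 3))
  exploration-within-degree w s bound with degree-view w
  ... | fork w~a w~b a≢b =
    explore-along-sweep (subst (RegularlyActive w ∘ suc) (length-neighbours w)
                               (regular-by-neighbours ∈-neighbours⁺))
                        bound (spanning-fork-sweep cuts-crossed w~a w~b a≢b s)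
  ... | leaf w~q only-q =
    exploration-mono 2K≤ (leaf-exploration w~q only-q s (≤-trans 2K≤ bound))
    where
      2K≤ : 2 * (2 * n ∸ 3) ≤ suc (Δ T E w) * (2 * n ∸ 3)
      2K≤ = *-monoˡ-≤ (2 * n ∸ 3)
              (s≤s (subst (1 ≤_) (length-neighbours w) (∈-length (∈-neighbours⁺ w~q))))

mainTheorem15 : (n : ℕ) → 2 ≤ n → (T : ℕ) → (E : TemporalGraph n) →
    NoLoops T E → SymmetricUnderlying T E → IsBroadcast T E → AlwaysConnected T E →
    (δ : ℕ) → IsMinDegree T E δ →
    (suc δ) * (2 * n ∸ 3) ≤ T →
    (s : Fin n) → ∃[ w ] (Explores T E {s} {0} w × lengthW T E w ≤ (suc δ) * (2 * n ∸ 3))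
mainTheorem15 n n≥2 T E no-loops symmetric broadcast connected δ ((w , Δw≡δ) , _) bound s =
  subst (λ d → Exploration s (suc d * (2 * n ∸ 3))) Δw≡δ
        (exploration-within-degree w s (subst (λ d → suc d * (2 * n ∸ 3) ≤ T) (sym Δw≡δ) bound))
  where
    T≥1 : 1 ≤ T
    T≥1 = ≤-trans (m+n≤o⇒m≤o∸n 1 (*-monoʳ-≤ 2 n≥2)) (≤-trans (m≤n*m (2 * n ∸ 3) (suc δ)) bound)
    open BroadcastExploration n≥2 T T≥1 E no-loops symmetric broadcast connected
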